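{- Let $n\geq 2$ and $i\geq 1$ be integers. Then \[\mathrm{dc}(\overrightarrow{C}_{n^2-n}[\overrightarrow{C}_n]^i)=\left\lceil \frac{n^2-n}{n^2-n-1}\,T_n(i)\right\rceil.\]
   Context: $\overrightarrow{C}_m$ is the directed cycle with vertex set $\mathbb{Z}_m$ and arcs $j\to j+1$. The lexicographic product $D[H]$ has vertex set $V(D)\times V(H)$, with an arc from $(u,a)$ to $(v,b)$ iff $uv\in A(D)$, or $u=v$ and $ab\in A(H)$; $D[H]^1=D[H]$ and $D[H]^i=(D[H]^{i-1})[H]$. The dichromatic number $\mathrm{dc}(D)$ is the smallest $k$ such that $V(D)$ can be partitioned into $k$ classes each inducing a subdigraph with no directed cycle. $T_n(0)=1$ and $T_n(i)=\lceil \tfrac{n}{n-1}T_n(i-1)\rceil$ for $i\geq 1$. -}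

module Defs where

open import Level using (0ℓ)
open import Data.Nat using (ℕ; zero; suc; _+_; _*_; _∸_; _≤_)
open import Data.Nat.DivMod using (_/_)
open import Data.Fin using (Fin; toℕ; inject₁; fromℕ) renaming (zero to fzero; suc to fsuc)
open import Data.Product using (_×_; _,_; Σ)
open import Data.Sum using (_⊎_)
open import Relation.Binary.PropositionalEquality using (_≡_)
open import Relation.Nullary using (¬_)
open import Function.Definitions using (Injective)

record Digraph : Set₁ where
  field
    V   : Set
    Arc : V → V → Set
open Digraph public

C⃗ : ℕ → Digraph
C⃗ m = record
  { V = Fin m
  ; Arc = λ a b → (suc (toℕ a) ≡ toℕ b) ⊎ ((suc (toℕ a) ≡ m) × (toℕ b ≡ 0)) }

_[_] : Digraph → Digraph → Digraph
D [ H ] = record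
  { V = V D × V H
  ; Arc = λ { (u , a) (v , b) → Arc D u v ⊎ ((u ≡ v) × Arc H a b) } }

_[_]^_ : Digraph → Digraph → ℕ → Digraph
D [ H ]^ zero  = D
D [ H ]^ suc i = (D [ H ]^ i) [ H ]

record DiCycle (D : Digraph) : Set where
  field
    len   : ℕ
    vtx   : Fin (suc len) → V D
    inj   : Injective _≡_ _≡_ vtx
    step  : (j : Fin len) → Arc D (vtx (inject₁ j)) (vtx (fsuc j))
    close : Arc D (vtx (fromℕ len)) (vtx fzero)

-- A k-colouring in which every colour class induces an acyclic subdigraph:
-- no directed cycle is monochromatic.
AcyclicColouring : (D : Digraph) → ℕ → Set
AcyclicColouring D k =
  Σ (V D → Fin k) λ f →
    (C : DiCycle D) → ¬ (∀ j → f (DiCycle.vtx C j) ≡ f (DiCycle.vtx C fzero))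

IsDichromaticNumber : Digraph → ℕ → Set
IsDichromaticNumber D k = AcyclicColouring D k × (∀ j → AcyclicColouring D j → k ≤ j)

-- ⌈ a / b ⌉ (b > 0; value for b = 0 is irrelevant).
⌈_/_⌉ : ℕ → ℕ → ℕ
⌈ a / zero ⌉  = 0
⌈ a / suc b ⌉ = (a + b) / suc b

T : ℕ → ℕ → ℕ
T n zero    = 1
T n (suc i) = ⌈ n * T n i / (n ∸ 1) ⌉

-- Everything rests on one step: if dc(K) = d then dc(C⃗ m [ K ]) = ⌈ m d / (m - 1) ⌉.
-- Upper bound: with k = d + e and d ≤ (m - 1) e, colour the copy of K over u ∈ C⃗ m
-- with the k colours outside the window [u e, u e + e).  A monochromatic cycle of
-- colour c avoids the copy whose window contains c, and a closed walk in C⃗ m that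
-- avoids a vertex stays in one place; so the cycle lies in a single copy of K.
-- Lower bound: in an acyclic j-colouring every copy of K sees at least d colours,
-- and no colour is seen by all m copies (else they would carry a monochromatic
-- transversal cycle); double counting gives m d ≤ (m - 1) j.
-- Since D[H]^i has the same acyclic colourings as D[H[H[⋯]]], iterating the step
-- computes dc(C⃗ n [ C⃗ n [ ⋯ ] ]) = T n i, and one more step gives the theorem.
module Submission where

open import Defs
open import Data.Nat using (ℕ; _≤_; _*_; _∸_)
open import Data.Nat
  using (zero; suc; _+_; _<_; z≤n; s≤s; s≤s⁻¹; _<?_; _≤?_; NonZero; >-nonZero)
open import Data.Nat.Properties hiding (0≢1+n; suc-injective)
open import Data.Nat.DivMod using (_/_; _%_; m≡m%n+[m/n]*n; m%n<n; m/n*n≤m; m<n*o⇒m/o<n)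
open import Algebra.Properties.CommutativeMonoid.Sum +-0-commutativeMonoid
  using (sum; sum-syntax; ∑-comm)
open import Data.Fin using (Fin; toℕ; inject₁; fromℕ; fromℕ<) renaming (zero to fzero; suc to fsuc)
open import Data.Fin.Properties
  using (¬Fin0; toℕ<n; toℕ-fromℕ<; toℕ-injective; toℕ-inject₁; toℕ-fromℕ; 0≢1+n; suc-injective)
open import Data.Product using (_×_; _,_; Σ; proj₁; proj₂)
open import Data.Product.Properties using (,-injectiveˡ; ,-injectiveʳ)
open import Data.Sum using (_⊎_; inj₁; inj₂; map₂)
open import Data.Unit using (⊤; tt)
open import Data.Empty using (⊥; ⊥-elim)
open import Function using (_∘_)
open import Relation.Binary.PropositionalEquality
  using (_≡_; _≢_; refl; sym; trans; cong; cong₂; subst; module ≡-Reasoning)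
open import Relation.Nullary using (¬_; Dec; yes; no; contradiction)
open import Relation.Nullary.Negation using (DoubleNegation)
open import Relation.Nullary.Decidable using (decidable-stable; ¬¬-excluded-middle)
open import Relation.Unary using (Decidable)

infix 4 _↪_
record _↪_ (D E : Digraph) : Set where
  field
    to            : V D → V E
    injective     : ∀ {x y} → to x ≡ to y → x ≡ y
    preserves-arc : ∀ {x y} → Arc D x y → Arc E (to x) (to y)
open _↪_

↪-trans : ∀ {D E F} → D ↪ E → E ↪ F → D ↪ F
↪-trans φ ψ = record
  { to            = to ψ ∘ to φ
  ; injective     = λ eq → injective φ (injective ψ eq)
  ; preserves-arc = λ a → preserves-arc ψ (preserves-arc φ a)
  }

infix 4 _⇄_
_⇄_ : Digraph → Digraph → Set
D ⇄ E = (D ↪ E) × (E ↪ D)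

⇄-sym : ∀ {D E} → D ⇄ E → E ⇄ D
⇄-sym (φ , ψ) = ψ , φ

⇄-trans : ∀ {D E F} → D ⇄ E → E ⇄ F → D ⇄ F
⇄-trans (φ , φ′) (ψ , ψ′) = ↪-trans φ ψ , ↪-trans ψ′ φ′

map-cycle : ∀ {D E} → D ↪ E → DiCycle D → DiCycle E
map-cycle φ C = record
  { len   = len
  ; vtx   = to φ ∘ vtx
  ; inj   = λ eq → inj (injective φ eq)
  ; step  = λ j → preserves-arc φ (step j)
  ; close = preserves-arc φ close
  }
  where open DiCycle C

Monochromatic : ∀ {D} {A : Set} → (V D → A) → DiCycle D → Set
Monochromatic f C = ∀ j → f (DiCycle.vtx C j) ≡ f (DiCycle.vtx C fzero)

colouring-pullback : ∀ {D E k} → D ↪ E → AcyclicColouring E k → AcyclicColouring D k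
colouring-pullback φ (f , acyclic) = f ∘ to φ , acyclic ∘ map-cycle φ

dc-transfer : ∀ {D E k} → D ⇄ E → IsDichromaticNumber E k → IsDichromaticNumber D k
dc-transfer (φ , ψ) (colouring , least) =
  colouring-pullback φ colouring , λ j c → least j (colouring-pullback ψ c)

K₁ : Digraph
K₁ = record { V = ⊤ ; Arc = λ _ _ → ⊥ }

[]-congˡ : ∀ {D E} H → D ↪ E → D [ H ] ↪ E [ H ]
[]-congˡ H φ = record
  { to            = λ { (u , a) → to φ u , a }
  ; injective     = λ eq → cong₂ _,_ (injective φ (,-injectiveˡ eq)) (,-injectiveʳ eq)
  ; preserves-arc = λ { (inj₁ a)          → inj₁ (preserves-arc φ a)
                      ; (inj₂ (refl , b)) → inj₂ (refl , b) }
  }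

[]-congʳ : ∀ {D E} H → D ↪ E → H [ D ] ↪ H [ E ]
[]-congʳ H φ = record
  { to            = λ { (u , a) → u , to φ a }
  ; injective     = λ eq → cong₂ _,_ (,-injectiveˡ eq) (injective φ (,-injectiveʳ eq))
  ; preserves-arc = λ { (inj₁ a)        → inj₁ a
                      ; (inj₂ (eq , b)) → inj₂ (eq , preserves-arc φ b) }
  }

[]-cong-⇄ˡ : ∀ {D E} H → D ⇄ E → D [ H ] ⇄ E [ H ]
[]-cong-⇄ˡ H (φ , ψ) = []-congˡ H φ , []-congˡ H ψ

[]-cong-⇄ʳ : ∀ {D E} H → D ⇄ E → H [ D ] ⇄ H [ E ]
[]-cong-⇄ʳ H (φ , ψ) = []-congʳ H φ , []-congʳ H ψ

[]-assoc : ∀ D H K → (D [ H ]) [ K ] ⇄ D [ H [ K ] ]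
[]-assoc D H K =
  record
    { to            = λ { ((u , a) , x) → u , (a , x) }
    ; injective     = λ { {(_ , _) , _} {(_ , _) , _} refl → refl }
    ; preserves-arc = λ { (inj₁ (inj₁ a))        → inj₁ a
                        ; (inj₁ (inj₂ (refl , b))) → inj₂ (refl , inj₁ b)
                        ; (inj₂ (refl , c))        → inj₂ (refl , inj₂ (refl , c)) }
    }
  , record
    { to            = λ { (u , (a , x)) → (u , a) , x }
    ; injective     = λ { {_ , (_ , _)} {_ , (_ , _)} refl → refl }
    ; preserves-arc = λ { (inj₁ a)                  → inj₁ (inj₁ a)
                        ; (inj₂ (refl , inj₁ b))        → inj₁ (inj₂ (refl , b))
                        ; (inj₂ (refl , inj₂ (refl , c))) → inj₂ (refl , c) }
    }

[]-identityʳ : ∀ D → D [ K₁ ] ⇄ D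
[]-identityʳ D =
  record { to = proj₁ ; injective = λ { {_ , tt} {_ , tt} refl → refl }
         ; preserves-arc = λ { (inj₁ a) → a ; (inj₂ (_ , ())) } }
  , record { to = _, tt ; injective = ,-injectiveˡ ; preserves-arc = inj₁ }

[]-identityˡ : ∀ D → K₁ [ D ] ⇄ D
[]-identityˡ D =
  record { to = proj₂ ; injective = λ { {tt , _} {tt , _} refl → refl }
         ; preserves-arc = λ { (inj₁ ()) ; (inj₂ (_ , a)) → a } }
  , record { to = tt ,_ ; injective = ,-injectiveʳ ; preserves-arc = λ a → inj₂ (refl , a) }

lexPower : Digraph → ℕ → Digraph
lexPower H zero    = K₁
lexPower H (suc i) = H [ lexPower H i ]

lexPower-[] : ∀ H i → lexPower H i [ H ] ⇄ H [ lexPower H i ]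
lexPower-[] H zero    = ⇄-trans ([]-identityˡ H) (⇄-sym ([]-identityʳ H))
lexPower-[] H (suc i) = ⇄-trans ([]-assoc H (lexPower H i) H) ([]-cong-⇄ʳ H (lexPower-[] H i))

[]^-lexPower : ∀ D H i → D [ H ]^ i ⇄ D [ lexPower H i ]
[]^-lexPower D H zero    = ⇄-sym ([]-identityʳ D)
[]^-lexPower D H (suc i) =
  ⇄-trans ([]-cong-⇄ˡ H ([]^-lexPower D H i))
    (⇄-trans ([]-assoc D (lexPower H i) H) ([]-cong-⇄ʳ D (lexPower-[] H i)))

copy : ∀ {D} K → V D → K ↪ D [ K ]
copy K u = record { to = u ,_ ; injective = ,-injectiveʳ ; preserves-arc = λ a → inj₂ (refl , a) }

cycle-in-one-copy : ∀ {D K} → (∀ {u} → ¬ Arc D u u) → (C : DiCycle (D [ K ])) →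
                    (∀ j → proj₁ (DiCycle.vtx C j) ≡ proj₁ (DiCycle.vtx C fzero)) → DiCycle K
cycle-in-one-copy {D} {K} irreflexive C same = record
  { len   = len
  ; vtx   = proj₂ ∘ vtx
  ; inj   = λ {i} {j} eq → inj (cong₂ _,_ (same′ i j) eq)
  ; step  = λ j → arc-in-copy (step j) (same′ _ _)
  ; close = arc-in-copy close (same′ _ _)
  }
  where
  open DiCycle C
  same′ : ∀ i j → proj₁ (vtx i) ≡ proj₁ (vtx j)
  same′ i j = trans (same i) (sym (same j))
  arc-in-copy : ∀ {u v x y} → Arc (D [ K ]) (u , x) (v , y) → u ≡ v → Arc K x y
  arc-in-copy (inj₁ a)       refl = ⊥-elim (irreflexive a)
  arc-in-copy (inj₂ (_ , a)) _    = a

section-cycle : ∀ {q K} → (Fin (suc q) → V K) → DiCycle (C⃗ (suc q) [ K ])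
section-cycle {q} s = record
  { len   = q
  ; vtx   = λ u → u , s u
  ; inj   = ,-injectiveˡ
  ; step  = λ u → inj₁ (inj₁ (cong suc (toℕ-inject₁ u)))
  ; close = inj₁ (inj₂ (cong suc (toℕ-fromℕ q) , refl))
  }

C⃗-irreflexive : ∀ {p} {u : Fin (suc (suc p))} → ¬ Arc (C⃗ (suc (suc p))) u u
C⃗-irreflexive {u = u} (inj₁ 1+u≡u) = <-irrefl (sym 1+u≡u) (n<1+n (toℕ u))
C⃗-irreflexive (inj₂ (1+u≡m , u≡0)) with trans (cong suc (sym u≡0)) 1+u≡m
... | ()

infix 4 _⊑[_]_
_⊑[_]_ : {A : Set} → A → (A → ℕ) → A → Set
x ⊑[ φ ] y = φ x < φ y ⊎ x ≡ y

module _ {A : Set} (φ : A → ℕ) where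

  ⊑-trans : ∀ {x y z} → x ⊑[ φ ] y → y ⊑[ φ ] z → x ⊑[ φ ] z
  ⊑-trans (inj₁ x<y) (inj₁ y<z) = inj₁ (<-trans x<y y<z)
  ⊑-trans (inj₁ x<y) (inj₂ refl) = inj₁ x<y
  ⊑-trans (inj₂ refl) y⊑z       = y⊑z

  ⊑-antisym : ∀ {x y} → x ⊑[ φ ] y → y ⊑[ φ ] x → x ≡ y
  ⊑-antisym (inj₁ x<y) (inj₁ y<x) = contradiction y<x (<-asym x<y)
  ⊑-antisym (inj₂ x≡y) _          = x≡y
  ⊑-antisym _          (inj₂ y≡x) = sym y≡x

  Climbing : ∀ {L} → (Fin (suc L) → A) → Set
  Climbing t = ∀ j → t (inject₁ j) ⊑[ φ ] t (fsuc j)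

  first-⊑ : ∀ {L} (t : Fin (suc L) → A) → Climbing t → ∀ j → t fzero ⊑[ φ ] t j
  first-⊑ t climbs fzero = inj₂ refl
  first-⊑ {suc L} t climbs (fsuc j) =
    ⊑-trans (climbs fzero) (first-⊑ (t ∘ fsuc) (climbs ∘ fsuc) j)

  ⊑-last : ∀ {L} (t : Fin (suc L) → A) → Climbing t → ∀ j → t j ⊑[ φ ] t (fromℕ L)
  ⊑-last {zero}  t climbs fzero    = inj₂ refl
  ⊑-last {suc L} t climbs fzero    =
    ⊑-trans (climbs fzero) (⊑-last (t ∘ fsuc) (climbs ∘ fsuc) fzero)
  ⊑-last {suc L} t climbs (fsuc j) = ⊑-last (t ∘ fsuc) (climbs ∘ fsuc) j

  climbing-closed-walk-constant : ∀ {L} (t : Fin (suc L) → A) → Climbing t →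
                                  t (fromℕ L) ⊑[ φ ] t fzero → ∀ j → t j ≡ t fzero
  climbing-closed-walk-constant t climbs close j =
    ⊑-antisym (⊑-trans (⊑-last t climbs j) close) (first-⊑ t climbs j)

-- C⃗ m cut open at u₀: this potential increases along every arc not leaving u₀.
rotation : ∀ {m} → Fin m → Fin m → ℕ
rotation {m} u₀ u with toℕ u₀ <? toℕ u
... | yes _ = toℕ u
... | no _  = m + toℕ u

rotation-arc : ∀ {m} (u₀ : Fin m) {u v} → u ≢ u₀ → Arc (C⃗ m) u v →
               rotation u₀ u < rotation u₀ v
rotation-arc {m} u₀ {u} {v} u≢u₀ arc with toℕ u₀ <? toℕ u | toℕ u₀ <? toℕ v | arc
... | yes _    | yes _    | inj₁ 1+u≡v       = ≤-reflexive 1+u≡v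
... | yes u₀<u | no u₀≮v  | inj₁ 1+u≡v       =
  contradiction (<-trans u₀<u (≤-reflexive 1+u≡v)) u₀≮v
... | no u₀≮u  | yes u₀<v | inj₁ 1+u≡v       =
  contradiction (toℕ-injective (≤-antisym (≮⇒≥ u₀≮u)
    (s≤s⁻¹ (subst (toℕ u₀ <_) (sym 1+u≡v) u₀<v)))) u≢u₀
... | no _     | no _     | inj₁ 1+u≡v       = +-monoʳ-< m (≤-reflexive 1+u≡v)
... | _        | yes u₀<v | inj₂ (_ , v≡0)   =
  contradiction (subst (toℕ u₀ <_) v≡0 u₀<v) n≮0
... | yes _    | no _     | inj₂ (1+u≡m , _) =
  ≤-trans (≤-reflexive 1+u≡m) (m≤m+n m (toℕ v))
... | no u₀≮u  | no _     | inj₂ (1+u≡m , _) =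
  contradiction (toℕ-injective (≤-antisym (≮⇒≥ u₀≮u)
    (s≤s⁻¹ (subst (toℕ u₀ <_) (sym 1+u≡m) (toℕ<n u₀))))) u≢u₀

avoiding-closed-walk-constant :
  ∀ {m L} (u₀ : Fin m) (t : Fin (suc L) → Fin m) → (∀ j → t j ≢ u₀) →
  (∀ j → Arc (C⃗ m) (t (inject₁ j)) (t (fsuc j)) ⊎ t (inject₁ j) ≡ t (fsuc j)) →
  Arc (C⃗ m) (t (fromℕ L)) (t fzero) ⊎ t (fromℕ L) ≡ t fzero →
  ∀ j → t j ≡ t fzero
avoiding-closed-walk-constant u₀ t avoids steps close =
  climbing-closed-walk-constant (rotation u₀) t (climb ∘ steps) (climb close)
  where
  climb : ∀ {i j} → Arc (C⃗ _) (t i) (t j) ⊎ t i ≡ t j → t i ⊑[ rotation u₀ ] t j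
  climb (inj₁ arc) = inj₁ (rotation-arc u₀ (avoids _) arc)
  climb (inj₂ eq)  = inj₂ eq

m<m/n*n+n : ∀ m n .{{_ : NonZero n}} → m < m / n * n + n
m<m/n*n+n m n = begin-strict
  m                 ≡⟨ m≡m%n+[m/n]*n m n ⟩
  m % n + m / n * n <⟨ +-monoˡ-< (m / n * n) (m%n<n m n) ⟩
  n + m / n * n     ≡⟨ +-comm n (m / n * n) ⟩
  m / n * n + n     ∎
  where open ≤-Reasoning

⌈/⌉-lower : ∀ a p → a ≤ suc p * ⌈ a / suc p ⌉
⌈/⌉-lower a p = +-cancelʳ-≤ p a (suc p * c) (s≤s⁻¹ (begin-strict
  a + p              <⟨ m<m/n*n+n (a + p) (suc p) ⟩
  c * suc p + suc p  ≡⟨ cong (_+ suc p) (*-comm c (suc p)) ⟩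
  suc p * c + suc p  ≡⟨ +-suc (suc p * c) p ⟩
  suc (suc p * c + p) ∎))
  where
  c = ⌈ a / suc p ⌉
  open ≤-Reasoning

⌈/⌉-least : ∀ a p j → a ≤ suc p * j → ⌈ a / suc p ⌉ ≤ j
⌈/⌉-least a p j a≤ = s≤s⁻¹ (m<n*o⇒m/o<n (begin-strict
  a + p               ≤⟨ +-monoˡ-≤ p a≤ ⟩
  suc p * j + p       <⟨ n<1+n _ ⟩
  suc (suc p * j + p) ≡⟨ cong suc (+-comm (suc p * j) p) ⟩
  suc p + suc p * j   ≡⟨ cong (suc p +_) (*-comm (suc p) j) ⟩
  suc j * suc p       ∎))
  where open ≤-Reasoning

[2+p]*d≤[1+p]*k⇒d<k : ∀ p {d k} → 0 < d → suc (suc p) * d ≤ suc p * k → d < k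
[2+p]*d≤[1+p]*k⇒d<k p {d} 0<d le =
  ≰⇒> (λ k≤d → <⇒≱ (≤-<-trans (*-monoʳ-≤ (suc p) k≤d) (m<n+m (suc p * d) 0<d)) le)

[2+p]*d≤[1+p]*[d+e]⇒d+e≤[2+p]*e : ∀ p d e → suc (suc p) * d ≤ suc p * (d + e) →
                                    d + e ≤ suc (suc p) * e
[2+p]*d≤[1+p]*[d+e]⇒d+e≤[2+p]*e p d e le = begin
  d + e         ≤⟨ +-monoˡ-≤ e d≤[1+p]*e ⟩
  suc p * e + e ≡⟨ +-comm (suc p * e) e ⟩
  suc (suc p) * e ∎
  where
  open ≤-Reasoning
  d≤[1+p]*e : d ≤ suc p * e
  d≤[1+p]*e = +-cancelˡ-≤ (suc p * d) d (suc p * e) (begin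
    suc p * d + d             ≡⟨ +-comm (suc p * d) d ⟩
    suc (suc p) * d           ≤⟨ le ⟩
    suc p * (d + e)           ≡⟨ *-distribˡ-+ (suc p) d e ⟩
    suc p * d + suc p * e     ∎)

skip : ℕ → ℕ → ℕ → ℕ
skip a e j with j <? a
... | yes _ = j
... | no _  = j + e

skip-< : ∀ a e {d j} → j < d → skip a e j < d + e
skip-< a e {d} {j} j<d with j <? a
... | yes _ = <-≤-trans j<d (m≤m+n d e)
... | no _  = +-monoˡ-< e j<d

skip-injective : ∀ a e {i j} → skip a e i ≡ skip a e j → i ≡ j
skip-injective a e {i} {j} eq with i <? a | j <? a
... | yes _   | yes _   = eq
... | no _    | no _    = +-cancelʳ-≡ e i j eq
... | yes i<a | no j≮a  =
  contradiction (≤-<-trans (≤-trans (m≤m+n j e) (≤-reflexive (sym eq))) i<a) j≮a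
... | no i≮a  | yes j<a =
  contradiction (≤-<-trans (≤-trans (m≤m+n i e) (≤-reflexive eq)) j<a) i≮a

skip-avoids-window : ∀ a e j {c} → a ≤ c → c < a + e → skip a e j ≢ c
skip-avoids-window a e j a≤c c<a+e eq with j <? a
... | yes j<a = <-irrefl eq (<-≤-trans j<a a≤c)
... | no j≮a  = <-irrefl (sym eq) (<-≤-trans c<a+e (+-monoˡ-≤ e (≮⇒≥ j≮a)))

module UpperBound (p : ℕ) {K : Digraph} {d e : ℕ} .{{_ : NonZero e}}
                  (colouring : AcyclicColouring K d) (d+e≤m*e : d + e ≤ suc (suc p) * e) where

  m : ℕ
  m = suc (suc p)

  g : V K → Fin d
  g = proj₁ colouring

  colour : V (C⃗ m [ K ]) → Fin (d + e)
  colour (u , x) = fromℕ< (skip-< (toℕ u * e) e (toℕ<n (g x)))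

  toℕ-colour : ∀ u x → toℕ (colour (u , x)) ≡ skip (toℕ u * e) e (toℕ (g x))
  toℕ-colour u x = toℕ-fromℕ< _

  missing-copy : (c : Fin (d + e)) → Σ (Fin m) λ u₀ → ∀ {v} → colour v ≡ c → proj₁ v ≢ u₀
  missing-copy c = fromℕ< u₀<m , λ { {u , x} colour≡c refl →
    skip-avoids-window a e (toℕ (g x)) (m/n*n≤m (toℕ c) e) (m<m/n*n+n (toℕ c) e) (begin
      skip a e (toℕ (g x))           ≡⟨ cong (λ w → skip (w * e) e _) (sym (toℕ-fromℕ< u₀<m)) ⟩
      skip (toℕ u * e) e (toℕ (g x)) ≡⟨ sym (toℕ-colour u x) ⟩
      toℕ (colour (u , x))           ≡⟨ cong toℕ colour≡c ⟩
      toℕ c                          ∎) }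
    where
    open ≡-Reasoning
    a = toℕ c / e * e
    u₀<m : toℕ c / e < m
    u₀<m = m<n*o⇒m/o<n (<-≤-trans (toℕ<n c) d+e≤m*e)

  colour-acyclic : (C : DiCycle (C⃗ m [ K ])) → ¬ Monochromatic colour C
  colour-acyclic C mono = proj₂ colouring (cycle-in-one-copy C⃗-irreflexive C same) g-mono
    where
    open DiCycle C
    open ≡-Reasoning
    copy-of : Fin (suc len) → Fin m
    copy-of = proj₁ ∘ vtx
    point : Fin (suc len) → V K
    point = proj₂ ∘ vtx
    u₀ = proj₁ (missing-copy (colour (vtx fzero)))
    same : ∀ j → copy-of j ≡ copy-of fzero
    same = avoiding-closed-walk-constant u₀ copy-of
             (λ j → proj₂ (missing-copy _) (mono j)) (map₂ proj₁ ∘ step) (map₂ proj₁ close)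
    a₀ = toℕ (copy-of fzero) * e
    g-mono : ∀ j → g (point j) ≡ g (point fzero)
    g-mono j = toℕ-injective (skip-injective a₀ e (begin
      skip a₀ e (toℕ (g (point j)))
        ≡⟨ cong (λ u → skip (toℕ u * e) e (toℕ (g (point j)))) (sym (same j)) ⟩
      skip (toℕ (copy-of j) * e) e (toℕ (g (point j)))
        ≡⟨ sym (toℕ-colour (copy-of j) (point j)) ⟩
      toℕ (colour (vtx j))
        ≡⟨ cong toℕ (mono j) ⟩
      toℕ (colour (vtx fzero))
        ≡⟨ toℕ-colour (copy-of fzero) (point fzero) ⟩
      skip a₀ e (toℕ (g (point fzero)))
        ∎))

  acyclic-colouring : AcyclicColouring (C⃗ m [ K ]) (d + e)
  acyclic-colouring = colour , colour-acyclic

upper-bound : ∀ p {K d} → AcyclicColouring K d →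
              AcyclicColouring (C⃗ (suc (suc p)) [ K ]) ⌈ suc (suc p) * d / suc p ⌉
upper-bound p {d = zero} (g , _) =
  (λ v → ⊥-elim (¬Fin0 (g (proj₂ v)))) , λ C _ → ¬Fin0 (g (proj₂ (DiCycle.vtx C fzero)))
upper-bound p {d = d@(suc _)} colouring =
  subst (AcyclicColouring _) d+e≡k
    (UpperBound.acyclic-colouring p {{>-nonZero (m<n⇒0<n∸m d<k)}} colouring
      ([2+p]*d≤[1+p]*[d+e]⇒d+e≤[2+p]*e p d (k ∸ d)
        (subst (λ k′ → suc (suc p) * d ≤ suc p * k′) (sym d+e≡k) md≤[m-1]k)))
  where
  k = ⌈ suc (suc p) * d / suc p ⌉
  md≤[m-1]k : suc (suc p) * d ≤ suc p * k
  md≤[m-1]k = ⌈/⌉-lower (suc (suc p) * d) p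
  d<k : d < k
  d<k = [2+p]*d≤[1+p]*k⇒d<k p (s≤s z≤n) md≤[m-1]k
  d+e≡k : d + (k ∸ d) ≡ k
  d+e≡k = m+[n∸m]≡n (<⇒≤ d<k)

∑-const : ∀ n a → ∑[ i < n ] a ≡ n * a
∑-const zero    a = refl
∑-const (suc n) a = cong (a +_) (∑-const n a)

∑-mono-≤ : ∀ {n} {f g : Fin n → ℕ} → (∀ i → f i ≤ g i) → sum f ≤ sum g
∑-mono-≤ {zero}  f≤g = z≤n
∑-mono-≤ {suc n} f≤g = +-mono-≤ (f≤g fzero) (∑-mono-≤ (f≤g ∘ fsuc))

indicator : ∀ {A : Set} → Dec A → ℕ
indicator (yes _) = 1
indicator (no _)  = 0

count : ∀ {n} {Q : Fin n → Set} → Decidable Q → ℕ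
count {n} Q? = ∑[ c < n ] indicator (Q? c)

count≤n : ∀ {n} {Q : Fin n → Set} (Q? : Decidable Q) → count Q? ≤ n
count≤n {zero}  Q? = z≤n
count≤n {suc n} Q? with Q? fzero
... | yes _ = s≤s (count≤n (Q? ∘ fsuc))
... | no _  = m≤n⇒m≤1+n (count≤n (Q? ∘ fsuc))

count<n : ∀ {n} {Q : Fin n → Set} (Q? : Decidable Q) → ¬ (∀ c → Q c) → count Q? < n
count<n {zero}  Q? ¬all = contradiction (λ ()) ¬all
count<n {suc n} Q? ¬all with Q? fzero
... | yes q₀ = s≤s (count<n (Q? ∘ fsuc) λ all → ¬all λ { fzero → q₀ ; (fsuc c) → all c })
... | no _   = s≤s (count≤n (Q? ∘ fsuc))

rank : ∀ {n} {Q : Fin n → Set} (Q? : Decidable Q) (c : Fin n) → Q c → Fin (count Q?)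
rank {suc n} Q? fzero q with Q? fzero
... | yes _  = fzero
... | no ¬q₀ = contradiction q ¬q₀
rank {suc n} Q? (fsuc c) q with Q? fzero
... | yes _ = fsuc (rank (Q? ∘ fsuc) c q)
... | no _  = rank (Q? ∘ fsuc) c q

rank-injective : ∀ {n} {Q : Fin n → Set} (Q? : Decidable Q) {c c′} (q : Q c) (q′ : Q c′) →
                 rank Q? c q ≡ rank Q? c′ q′ → c ≡ c′
rank-injective {suc n} Q? {fzero}  {fzero}   q q′ eq = refl
rank-injective {suc n} Q? {fzero}  {fsuc c′} q q′ eq with Q? fzero
... | yes _  = contradiction eq 0≢1+n
... | no ¬q₀ = contradiction q ¬q₀
rank-injective {suc n} Q? {fsuc c} {fzero}   q q′ eq with Q? fzero
... | yes _  = contradiction (sym eq) 0≢1+n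
... | no ¬q₀ = contradiction q′ ¬q₀
rank-injective {suc n} Q? {fsuc c} {fsuc c′} q q′ eq with Q? fzero
... | yes _ = cong fsuc (rank-injective (Q? ∘ fsuc) q q′ (suc-injective eq))
... | no _  = cong fsuc (rank-injective (Q? ∘ fsuc) q q′ eq)

compress-colouring : ∀ {K j} {Q : Fin j → Set} (Q? : Decidable Q)
                     (colouring : AcyclicColouring K j) → (∀ x → Q (proj₁ colouring x)) →
                     AcyclicColouring K (count Q?)
compress-colouring Q? (f , acyclic) used =
  (λ x → rank Q? (f x) (used x)) , λ C mono → acyclic C (λ j → rank-injective Q? _ _ (mono j))

¬¬-∀-Fin : ∀ {n} {Q : Fin n → Set} → (∀ i → DoubleNegation (Q i)) →
           DoubleNegation (∀ i → Q i)
¬¬-∀-Fin {zero}  _   k = k (λ ())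
¬¬-∀-Fin {suc n} ¬¬Q k =
  ¬¬Q fzero λ q₀ → ¬¬-∀-Fin (¬¬Q ∘ fsuc) λ qs → k λ { fzero → q₀ ; (fsuc i) → qs i }

module LowerBound (p : ℕ) {K : Digraph} {d j : ℕ}
                  (d-least : ∀ k → AcyclicColouring K k → d ≤ k)
                  (colouring : AcyclicColouring (C⃗ (suc (suc p)) [ K ]) j) where

  m : ℕ
  m = suc (suc p)

  Uses : Fin m → Fin j → Set
  Uses u c = Σ (V K) λ x → proj₁ colouring (u , x) ≡ c

  no-colour-in-every-copy : ∀ c → ¬ (∀ u → Uses u c)
  no-colour-in-every-copy c uses =
    proj₂ colouring (section-cycle (proj₁ ∘ uses))
      λ u → trans (proj₂ (uses u)) (sym (proj₂ (uses fzero)))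

  module _ (uses? : ∀ u → Decidable (Uses u)) where

    colours-per-copy : ∀ u → d ≤ count (uses? u)
    colours-per-copy u =
      d-least _ (compress-colouring (uses? u) (colouring-pullback (copy K u) colouring) (_, refl))

    copies-per-colour : ∀ c → count (λ u → uses? u c) ≤ suc p
    copies-per-colour c = s≤s⁻¹ (count<n (λ u → uses? u c) (no-colour-in-every-copy c))

    double-count : m * d ≤ suc p * j
    double-count = begin
      m * d                                     ≡⟨ sym (∑-const m d) ⟩
      ∑[ u < m ] d                              ≤⟨ ∑-mono-≤ colours-per-copy ⟩
      ∑[ u < m ] ∑[ c < j ] indicator (uses? u c) ≡⟨ ∑-comm (λ u c → indicator (uses? u c)) ⟩
      ∑[ c < j ] ∑[ u < m ] indicator (uses? u c) ≤⟨ ∑-mono-≤ copies-per-colour ⟩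
      ∑[ c < j ] suc p                          ≡⟨ ∑-const j (suc p) ⟩
      j * suc p                                 ≡⟨ *-comm j (suc p) ⟩
      suc p * j                                 ∎
      where open ≤-Reasoning

  -- Uses u c need not be decidable, but the conclusion is, so excluded middle may be assumed.
  md≤[m-1]j : m * d ≤ suc p * j
  md≤[m-1]j = decidable-stable (m * d ≤? suc p * j) λ ¬bound →
    ¬¬-∀-Fin (λ u → ¬¬-∀-Fin (λ c → ¬¬-excluded-middle)) (¬bound ∘ double-count)

lower-bound : ∀ p {K d j} → (∀ k → AcyclicColouring K k → d ≤ k) →
              AcyclicColouring (C⃗ (suc (suc p)) [ K ]) j → ⌈ suc (suc p) * d / suc p ⌉ ≤ j
lower-bound p {d = d} {j} d-least colouring =
  ⌈/⌉-least (suc (suc p) * d) p j (LowerBound.md≤[m-1]j p d-least colouring)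

dc-C⃗[] : ∀ p {K d} → IsDichromaticNumber K d →
          IsDichromaticNumber (C⃗ (suc (suc p)) [ K ]) ⌈ suc (suc p) * d / suc p ⌉
dc-C⃗[] p (colouring , least) = upper-bound p colouring , λ j → lower-bound p least

dc-K₁ : IsDichromaticNumber K₁ 1
dc-K₁ = ((λ _ → fzero) , λ C _ → DiCycle.close C)
      , λ { zero (f , _) → ⊥-elim (¬Fin0 (f tt)) ; (suc _) _ → s≤s z≤n }

dc-lexPower-C⃗ : ∀ p i → IsDichromaticNumber (lexPower (C⃗ (suc (suc p))) i) (T (suc (suc p)) i)
dc-lexPower-C⃗ p zero    = dc-K₁
dc-lexPower-C⃗ p (suc i) = dc-C⃗[] p (dc-lexPower-C⃗ p i)

theorem18 : (n i : ℕ) → 2 ≤ n → 1 ≤ i →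
    IsDichromaticNumber (C⃗ (n * n ∸ n) [ C⃗ n ]^ i)
    ⌈ (n * n ∸ n) * T n i / (n * n ∸ n ∸ 1) ⌉
theorem18 n@(suc (suc p)) i (s≤s (s≤s z≤n)) _ =
  subst (λ M → IsDichromaticNumber (C⃗ M [ C⃗ n ]^ i) ⌈ M * T n i / (M ∸ 1) ⌉) (sym n*n∸n≡2+q)
    (dc-transfer ([]^-lexPower (C⃗ (suc (suc q))) (C⃗ n) i) (dc-C⃗[] q (dc-lexPower-C⃗ p i)))
  where
  q = p + p * n
  n*n∸n≡2+q : n * n ∸ n ≡ suc (suc q)
  n*n∸n≡2+q = m+n∸m≡n n (suc p * n)
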